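{- Any almost $n$-ary theory $T$ is $k$-ary for some $k\geq n$.
   Context: For $n\geq 1$, a formula $\varphi(\overline{x})$ of a first-order theory $T$ is called $n$-ary (an $n$-formula) if it is $T$-equivalent to a Boolean combination of $T$-formulas each of which has $n$ free variables. $T$ is unary if every $T$-formula is $T$-equivalent to a Boolean combination of $T$-formulas with one free variable and formulas $x\approx y$; for $n\geq 2$, $T$ is $n$-ary if every $T$-formula is $n$-ary. $T$ is almost $n$-ary if there are finitely many formulas $\varphi_1(\overline{x}),\ldots,\varphi_m(\overline{x})$ such that every $T$-formula is $T$-equivalent to a Boolean combination of $n$-formulas and of formulas obtained from $\varphi_1(\overline{x}),\ldots,\varphi_m(\overline{x})$ by substitutions of free variables. -}

module Defs where

open import Data.Nat using (ℕ; zero; suc)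
open import Data.Fin using (Fin)
open import Data.List using (List; length)
open import Data.List.Membership.Propositional using (_∈_)
open import Data.List.Relation.Unary.Unique.Propositional using (Unique)
open import Data.Product using (Σ; ∃; _×_; _,_)
open import Data.Sum using (_⊎_)
open import Data.Empty using (⊥)
open import Relation.Nullary using (¬_)
open import Relation.Binary.PropositionalEquality using (_≡_)
open import Function.Bundles using (_⇔_)
open import Level using (Lift)
import Level

record Signature : Set₁ where
  field
    Fun      : Set
    funArity : Fun → ℕ
    Rel      : Set
    relArity : Rel → ℕ

module _ (L : Signature) where
  open Signature L

  -- Terms; variables are de Bruijn indices.
  data Term : Set where
    var : ℕ → Term
    fn  : (f : Fun) → (Fin (funArity f) → Term) → Term

  -- Formulas (∃ binds de Bruijn index 0); ∨, →, ∀ are derived.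
  data Formula : Set where
    ⊥ᶠ   : Formula
    _≈ᶠ_ : Term → Term → Formula
    rel  : (r : Rel) → (Fin (relArity r) → Term) → Formula
    ¬ᶠ_  : Formula → Formula
    _∧ᶠ_ : Formula → Formula → Formula
    ∃ᶠ_  : Formula → Formula

  data FreeT (x : ℕ) : Term → Set where
    var : FreeT x (var x)
    fn  : ∀ {f ts} (i : Fin (funArity f)) → FreeT x (ts i) → FreeT x (fn f ts)

  data Free : ℕ → Formula → Set where
    ≈ˡ  : ∀ {x s t} → FreeT x s → Free x (s ≈ᶠ t)
    ≈ʳ  : ∀ {x s t} → FreeT x t → Free x (s ≈ᶠ t)
    rel : ∀ {x r ts} (i : Fin (relArity r)) → FreeT x (ts i) → Free x (rel r ts)
    ¬ᶠ_ : ∀ {x φ} → Free x φ → Free x (¬ᶠ φ)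
    ∧ˡ  : ∀ {x φ ψ} → Free x φ → Free x (φ ∧ᶠ ψ)
    ∧ʳ  : ∀ {x φ ψ} → Free x ψ → Free x (φ ∧ᶠ ψ)
    ∃ᶠ_ : ∀ {x φ} → Free (suc x) φ → Free x (∃ᶠ φ)

  HasFreeVars : ℕ → Formula → Set
  HasFreeVars n φ =
    Σ (List ℕ) λ xs → length xs ≡ n × Unique xs × (∀ x → Free x φ ⇔ x ∈ xs)

  lift : (ℕ → ℕ) → ℕ → ℕ
  lift σ zero    = zero
  lift σ (suc i) = suc (σ i)

  renameT : (ℕ → ℕ) → Term → Term
  renameT σ (var x)  = var (σ x)
  renameT σ (fn f ts) = fn f (λ i → renameT σ (ts i))

  rename : (ℕ → ℕ) → Formula → Formula
  rename σ ⊥ᶠ        = ⊥ᶠ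
  rename σ (s ≈ᶠ t)  = renameT σ s ≈ᶠ renameT σ t
  rename σ (rel r ts) = rel r (λ i → renameT σ (ts i))
  rename σ (¬ᶠ φ)    = ¬ᶠ rename σ φ
  rename σ (φ ∧ᶠ ψ)  = rename σ φ ∧ᶠ rename σ ψ
  rename σ (∃ᶠ φ)    = ∃ᶠ rename (lift σ) φ

  record Structure : Set₁ where
    field
      Carrier : Set
      funI    : (f : Fun) → (Fin (funArity f) → Carrier) → Carrier
      relI    : (r : Rel) → (Fin (relArity r) → Carrier) → Set

  module _ (M : Structure) where
    open Structure M

    _∷ₐ_ : Carrier → (ℕ → Carrier) → ℕ → Carrier
    (a ∷ₐ ρ) zero    = a
    (a ∷ₐ ρ) (suc i) = ρ i

    eval : (ℕ → Carrier) → Term → Carrier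
    eval ρ (var x)   = ρ x
    eval ρ (fn f ts) = funI f (λ i → eval ρ (ts i))

    Sat : (ℕ → Carrier) → Formula → Set
    Sat ρ ⊥ᶠ         = ⊥
    Sat ρ (s ≈ᶠ t)   = eval ρ s ≡ eval ρ t
    Sat ρ (rel r ts) = relI r (λ i → eval ρ (ts i))
    Sat ρ (¬ᶠ φ)     = ¬ Sat ρ φ
    Sat ρ (φ ∧ᶠ ψ)   = Sat ρ φ × Sat ρ ψ
    Sat ρ (∃ᶠ φ)     = Σ Carrier λ a → Sat (a ∷ₐ ρ) φ

  record Theory : Set₁ where
    field
      Ax     : Formula → Set
      closed : ∀ φ → Ax φ → ∀ x → ¬ Free x φ

  module _ (T : Theory) where
    open Theory T

    IsModel : Structure → Set
    IsModel M = ∀ φ → Ax φ → ∀ ρ → Sat M ρ φ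

    _≡ₜ_ : Formula → Formula → Set₁
    φ ≡ₜ ψ = ∀ (M : Structure) → IsModel M → ∀ ρ → Sat M ρ φ ⇔ Sat M ρ ψ

  data BoolComb (P : Formula → Set₁) : Formula → Set₁ where
    base : ∀ {φ} → P φ → BoolComb P φ
    neg  : ∀ {φ} → BoolComb P φ → BoolComb P (¬ᶠ φ)
    conj : ∀ {φ ψ} → BoolComb P φ → BoolComb P ψ → BoolComb P (φ ∧ᶠ ψ)

  module _ (T : Theory) where

    EquivBC : (Formula → Set₁) → Formula → Set₁
    EquivBC P φ = Σ Formula λ ψ → BoolComb P ψ × _≡ₜ_ T φ ψ

    NFormula : ℕ → Formula → Set₁
    NFormula n = EquivBC (λ ψ → Lift (Level.suc Level.zero) (HasFreeVars n ψ))

    Unary : Set₁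
    Unary = ∀ φ → EquivBC
      (λ ψ → Lift (Level.suc Level.zero) (HasFreeVars 1 ψ ⊎ (Σ ℕ λ x → Σ ℕ λ y → ψ ≡ (var x ≈ᶠ var y)))) φ

    -- T is k-ary: unary for k = 1, every formula is k-ary for k ≥ 2
    -- (k = 0 is not defined in the paper; taken as false).
    Ary : ℕ → Set₁
    Ary zero          = Lift (Level.suc Level.zero) ⊥
    Ary (suc zero)    = Unary
    Ary (suc (suc k)) = ∀ φ → NFormula (suc (suc k)) φ

    AlmostAry : ℕ → Set₁
    AlmostAry n = Σ (List Formula) λ φs → ∀ φ → EquivBC
      (λ ψ → NFormula n ψ ⊎ Lift (Level.suc Level.zero)
         (Σ Formula λ χ → χ ∈ φs × Σ (ℕ → ℕ) λ σ → ψ ≡ rename σ χ)) φ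

-- Take k ≥ n so large that it bounds the variable indices of the finitely many extra
-- formulas φ₁ … φₘ.  The constituents of n-formulas, and all renamings of the φᵢ
-- (renaming cannot increase the number of free variables), then have at most k free
-- variables.  Conjoining trivial equations x ≈ x on fresh variables makes each of them
-- T-equivalent to a formula with exactly k free variables, and a Boolean combination
-- of k-formulas is a k-formula.
module Submission where

open import Defs hiding (lift)
open import Data.Nat using (ℕ; _≤_; _≥_; suc; _+_; _⊔_; _<_; _≤′_; ≤′-refl; ≤′-step; s≤s; _≟_)
open import Data.Nat.Properties
  using (≤-refl; ≤-trans; <-≤-trans; <-trans; <-irrefl; n<1+n; m≤m⊔n; m≤n⊔m; m≤m+n; m≤n+m; ≤⇒≤′)
open import Data.Fin using (Fin)
open import Data.Fin.Properties using (any?)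
open import Data.List using (_∷_; length; map; filter; upTo; deduplicate; tabulate)
open import Data.List.Properties using (length-filter; length-deduplicate; length-map; length-upTo)
open import Data.List.Extrema.Nat using (max; v<max⁺; xs≤max)
open import Data.List.Membership.Propositional using (_∈_)
open import Data.List.Membership.Propositional.Properties
  using (∈-filter⁺; ∈-filter⁻; ∈-deduplicate⁺; ∈-upTo⁺; ∈-map⁺)
open import Data.List.Relation.Unary.Any using (here; there)
import Data.List.Relation.Unary.Any.Properties as Any
import Data.List.Relation.Unary.All as All
open import Data.List.Relation.Unary.AllPairs using (_∷_)
open import Data.List.Relation.Unary.Unique.Propositional.Properties using (filter⁺)
open import Data.List.Relation.Unary.Unique.DecPropositional.Properties _≟_ using (deduplicate-!)
open import Data.Product using (Σ; _×_; _,_; proj₁; proj₂; ∃)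
open import Data.Sum using (_⊎_; inj₁; inj₂)
open import Data.Empty using (⊥)
open import Relation.Nullary using (Dec; yes; no)
open import Relation.Binary.PropositionalEquality using (_≡_; refl; trans; subst)
open import Function using (id; _∘_)
open import Function.Bundles using (mk⇔; Equivalence)
open import Level using (Lift; lift)

open Equivalence

<max-tabulate : ∀ {n v} (g : Fin n → ℕ) i → v < g i → v < max 0 (tabulate g)
<max-tabulate g i v<gi = v<max⁺ 0 (tabulate g) (inj₂ (Any.tabulate⁺ i v<gi))

module _ (L : Signature) where
  open Signature L

  freeᵗ? : ∀ x (t : Term L) → Dec (FreeT L x t)
  freeᵗ? x (var y) with x ≟ y
  ... | yes refl = yes var
  ... | no x≢y   = no λ { var → x≢y refl }
  freeᵗ? x (fn f ts) with any? (λ i → freeᵗ? x (ts i))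
  ... | yes (i , p) = yes (fn i p)
  ... | no ¬p       = no λ { (fn i p) → ¬p (i , p) }

  free? : ∀ x (φ : Formula L) → Dec (Free L x φ)
  free? x ⊥ᶠ = no λ ()
  free? x (s ≈ᶠ t) with freeᵗ? x s | freeᵗ? x t
  ... | yes p | _     = yes (≈ˡ p)
  ... | no _  | yes q = yes (≈ʳ q)
  ... | no ¬p | no ¬q = no λ { (≈ˡ p) → ¬p p ; (≈ʳ q) → ¬q q }
  free? x (rel r ts) with any? (λ i → freeᵗ? x (ts i))
  ... | yes (i , p) = yes (rel i p)
  ... | no ¬p       = no λ { (rel i p) → ¬p (i , p) }
  free? x (¬ᶠ φ) with free? x φ
  ... | yes p = yes (¬ᶠ p)
  ... | no ¬p = no λ { (¬ᶠ p) → ¬p p }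
  free? x (φ ∧ᶠ ψ) with free? x φ | free? x ψ
  ... | yes p | _     = yes (∧ˡ p)
  ... | no _  | yes q = yes (∧ʳ q)
  ... | no ¬p | no ¬q = no λ { (∧ˡ p) → ¬p p ; (∧ʳ q) → ¬q q }
  free? x (∃ᶠ φ) with free? (suc x) φ
  ... | yes p = yes (∃ᶠ p)
  ... | no ¬p = no λ { (∃ᶠ p) → ¬p p }

  varBoundᵗ : Term L → ℕ
  varBoundᵗ (var x)   = suc x
  varBoundᵗ (fn f ts) = max 0 (tabulate (λ i → varBoundᵗ (ts i)))

  varBound : Formula L → ℕ
  varBound ⊥ᶠ         = 0
  varBound (s ≈ᶠ t)   = varBoundᵗ s ⊔ varBoundᵗ t
  varBound (rel r ts) = max 0 (tabulate (λ i → varBoundᵗ (ts i)))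
  varBound (¬ᶠ φ)     = varBound φ
  varBound (φ ∧ᶠ ψ)   = varBound φ ⊔ varBound ψ
  varBound (∃ᶠ φ)     = varBound φ

  FreeT⇒<varBoundᵗ : ∀ {x t} → FreeT L x t → x < varBoundᵗ t
  FreeT⇒<varBoundᵗ var                    = ≤-refl
  FreeT⇒<varBoundᵗ {t = fn f ts} (fn i p) = <max-tabulate (varBoundᵗ ∘ ts) i (FreeT⇒<varBoundᵗ p)

  Free⇒<varBound : ∀ {x φ} → Free L x φ → x < varBound φ
  Free⇒<varBound (≈ˡ p)                   = <-≤-trans (FreeT⇒<varBoundᵗ p) (m≤m⊔n _ _)
  Free⇒<varBound (≈ʳ p)                   = <-≤-trans (FreeT⇒<varBoundᵗ p) (m≤n⊔m _ _)
  Free⇒<varBound {φ = rel r ts} (rel i p) = <max-tabulate (varBoundᵗ ∘ ts) i (FreeT⇒<varBoundᵗ p)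
  Free⇒<varBound (¬ᶠ p)                   = Free⇒<varBound p
  Free⇒<varBound (∧ˡ p)                   = <-≤-trans (Free⇒<varBound p) (m≤m⊔n _ _)
  Free⇒<varBound (∧ʳ p)                   = <-≤-trans (Free⇒<varBound p) (m≤n⊔m _ _)
  Free⇒<varBound (∃ᶠ p)                   = <-trans (n<1+n _) (Free⇒<varBound p)

  FreeT-renameT⁻ : ∀ {σ y} t → FreeT L y (renameT L σ t) → ∃ λ x → FreeT L x t × σ x ≡ y
  FreeT-renameT⁻ (var x)   var      = x , var , refl
  FreeT-renameT⁻ (fn f ts) (fn i p) with FreeT-renameT⁻ (ts i) p
  ... | x , q , σx≡y = x , fn i q , σx≡y

  Free-rename⁻ : ∀ {σ y} φ → Free L y (rename L σ φ) → ∃ λ x → Free L x φ × σ x ≡ y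
  Free-rename⁻ (s ≈ᶠ t) (≈ˡ p) with FreeT-renameT⁻ s p
  ... | x , q , σx≡y = x , ≈ˡ q , σx≡y
  Free-rename⁻ (s ≈ᶠ t) (≈ʳ p) with FreeT-renameT⁻ t p
  ... | x , q , σx≡y = x , ≈ʳ q , σx≡y
  Free-rename⁻ (rel r ts) (rel i p) with FreeT-renameT⁻ (ts i) p
  ... | x , q , σx≡y = x , rel i q , σx≡y
  Free-rename⁻ (¬ᶠ φ) (¬ᶠ p) with Free-rename⁻ φ p
  ... | x , q , σx≡y = x , ¬ᶠ q , σx≡y
  Free-rename⁻ (φ ∧ᶠ ψ) (∧ˡ p) with Free-rename⁻ φ p
  ... | x , q , σx≡y = x , ∧ˡ q , σx≡y
  Free-rename⁻ (φ ∧ᶠ ψ) (∧ʳ p) with Free-rename⁻ ψ p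
  ... | x , q , σx≡y = x , ∧ʳ q , σx≡y
  Free-rename⁻ (∃ᶠ φ) (∃ᶠ p) with Free-rename⁻ φ p
  ... | suc x , q , refl = x , ∃ᶠ q , refl

  HasFreeVars-⊆ : ∀ {φ} ys → (∀ {x} → Free L x φ → x ∈ ys) →
                  ∃ λ m → m ≤ length ys × HasFreeVars L m φ
  HasFreeVars-⊆ {φ} ys free⊆ys =
    length xs , ≤-trans (length-filter Free? ys′) (length-deduplicate _≟_ ys) ,
    xs , refl , filter⁺ Free? (deduplicate-! ys) ,
    λ x → mk⇔ (λ p → ∈-filter⁺ Free? (∈-deduplicate⁺ _≟_ (free⊆ys p)) p)
              (λ x∈xs → proj₂ (∈-filter⁻ Free? {xs = ys′} x∈xs))
    where
    Free? = λ x → free? x φ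
    ys′ = deduplicate _≟_ ys
    xs = filter Free? ys′

  HasFreeVars-rename : ∀ σ φ → ∃ λ m → m ≤ varBound φ × HasFreeVars L m (rename L σ φ)
  HasFreeVars-rename σ φ with HasFreeVars-⊆ ys free⊆ys
    where
    ys = map σ (upTo (varBound φ))
    free⊆ys : ∀ {y} → Free L y (rename L σ φ) → y ∈ ys
    free⊆ys p with Free-rename⁻ φ p
    ... | x , q , refl = ∈-map⁺ σ (∈-upTo⁺ (Free⇒<varBound q))
  ... | m , m≤∣ys∣ , h = m , subst (m ≤_) ∣ys∣≡ m≤∣ys∣ , h
    where
    ∣ys∣≡ : length (map σ (upTo (varBound φ))) ≡ varBound φ
    ∣ys∣≡ = trans (length-map σ (upTo (varBound φ))) (length-upTo (varBound φ))

  module _ (T : Theory L) where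
    private
      _≃_ = _≡ₜ_ L T

    ≡ₜ-refl : ∀ {φ} → φ ≃ φ
    ≡ₜ-refl M _ ρ = mk⇔ id id

    ≡ₜ-trans : ∀ {φ ψ χ} → φ ≃ ψ → ψ ≃ χ → φ ≃ χ
    ≡ₜ-trans φ≡ψ ψ≡χ M M⊨T ρ =
      mk⇔ (to (ψ≡χ M M⊨T ρ) ∘ to (φ≡ψ M M⊨T ρ)) (from (φ≡ψ M M⊨T ρ) ∘ from (ψ≡χ M M⊨T ρ))

    ¬ᶠ-cong : ∀ {φ ψ} → φ ≃ ψ → (¬ᶠ φ) ≃ (¬ᶠ ψ)
    ¬ᶠ-cong φ≡ψ M M⊨T ρ = mk⇔ (λ ¬φ → ¬φ ∘ from (φ≡ψ M M⊨T ρ)) (λ ¬ψ → ¬ψ ∘ to (φ≡ψ M M⊨T ρ))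

    ∧ᶠ-cong : ∀ {φ φ′ ψ ψ′} → φ ≃ φ′ → ψ ≃ ψ′ → (φ ∧ᶠ ψ) ≃ (φ′ ∧ᶠ ψ′)
    ∧ᶠ-cong φ≡φ′ ψ≡ψ′ M M⊨T ρ =
      mk⇔ (λ (a , b) → to (φ≡φ′ M M⊨T ρ) a , to (ψ≡ψ′ M M⊨T ρ) b)
          (λ (a , b) → from (φ≡φ′ M M⊨T ρ) a , from (ψ≡ψ′ M M⊨T ρ) b)

    BoolComb-bind : ∀ {P Q} → (∀ {ψ} → P ψ → EquivBC L T Q ψ) →
                    ∀ {φ} → BoolComb L P φ → EquivBC L T Q φ
    BoolComb-bind f (base p) = f p
    BoolComb-bind f (neg {φ} b) with BoolComb-bind f b
    ... | φ′ , b′ , φ≡φ′ = ¬ᶠ φ′ , neg b′ , ¬ᶠ-cong {φ} {φ′} φ≡φ′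
    BoolComb-bind f (conj {φ} {ψ} b c) with BoolComb-bind f b | BoolComb-bind f c
    ... | φ′ , b′ , φ≡φ′ | ψ′ , c′ , ψ≡ψ′ =
      φ′ ∧ᶠ ψ′ , conj b′ c′ , ∧ᶠ-cong {φ} {φ′} {ψ} {ψ′} φ≡φ′ ψ≡ψ′

    EquivBC-bind : ∀ {P Q} → (∀ {ψ} → P ψ → EquivBC L T Q ψ) →
                   ∀ {φ} → EquivBC L T P φ → EquivBC L T Q φ
    EquivBC-bind f {φ} (ψ , b , φ≡ψ) with BoolComb-bind f b
    ... | ψ′ , b′ , ψ≡ψ′ = ψ′ , b′ , ≡ₜ-trans {φ} {ψ} {ψ′} φ≡ψ ψ≡ψ′

    -- The witness is θ ∧ (y ≈ y) for y above all free variables of θ.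
    HasFreeVars-suc : ∀ {m θ} → HasFreeVars L m θ → ∃ λ θ′ → HasFreeVars L (suc m) θ′ × θ ≃ θ′
    HasFreeVars-suc {θ = θ} (xs , refl , unique , free⇔) =
      θ ∧ᶠ (var y ≈ᶠ var y) ,
      (y ∷ xs , refl , All.tabulate y≢ ∷ unique , λ x → mk⇔ (free⇒∈ x) (∈⇒free x)) ,
      λ M _ ρ → mk⇔ (_, refl) proj₁
      where
      y = suc (max 0 xs)
      y≢ : ∀ {x} → x ∈ xs → y ≡ x → ⊥
      y≢ x∈xs refl = <-irrefl refl (s≤s (All.lookup (xs≤max 0 xs) x∈xs))
      free⇒∈ : ∀ x → Free L x (θ ∧ᶠ (var y ≈ᶠ var y)) → x ∈ y ∷ xs
      free⇒∈ x (∧ˡ p)         = there (to (free⇔ x) p)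
      free⇒∈ x (∧ʳ (≈ˡ var)) = here refl
      free⇒∈ x (∧ʳ (≈ʳ var)) = here refl
      ∈⇒free : ∀ x → x ∈ y ∷ xs → Free L x (θ ∧ᶠ (var y ≈ᶠ var y))
      ∈⇒free x (here refl)  = ∧ʳ (≈ˡ var)
      ∈⇒free x (there x∈xs) = ∧ˡ (from (free⇔ x) x∈xs)

    HasFreeVars-pad : ∀ {m k θ} → m ≤′ k → HasFreeVars L m θ →
                      ∃ λ θ′ → HasFreeVars L k θ′ × θ ≃ θ′
    HasFreeVars-pad {θ = θ} ≤′-refl h = θ , h , ≡ₜ-refl {θ}
    HasFreeVars-pad {θ = θ} (≤′-step m≤′k) h with HasFreeVars-pad m≤′k h
    ... | θ′ , h′ , θ≡θ′ with HasFreeVars-suc h′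
    ... | θ″ , h″ , θ′≡θ″ = θ″ , h″ , ≡ₜ-trans {θ} {θ′} {θ″} θ≡θ′ θ′≡θ″

    HasFreeVars⇒NFormula : ∀ {m k θ} → m ≤ k → HasFreeVars L m θ → NFormula L T k θ
    HasFreeVars⇒NFormula m≤k h with HasFreeVars-pad (≤⇒≤′ m≤k) h
    ... | θ′ , h′ , θ≡θ′ = θ′ , base (lift h′) , θ≡θ′

    NFormula-mono : ∀ {n k φ} → n ≤ k → NFormula L T n φ → NFormula L T k φ
    NFormula-mono {φ = φ} n≤k = EquivBC-bind (λ (lift h) → HasFreeVars⇒NFormula n≤k h) {φ}

    rename-NFormula : ∀ {k} σ φ → varBound φ ≤ k → NFormula L T k (rename L σ φ)
    rename-NFormula σ φ bound≤k with HasFreeVars-rename σ φ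
    ... | m , m≤bound , h = HasFreeVars⇒NFormula (≤-trans m≤bound bound≤k) h

-- The summand 2 places k in the clause of Ary asking for k-formulas rather than unary
-- ones.
proposition2p3 : (L : Signature) (T : Theory L) (n : ℕ) → n ≥ 1 →
    AlmostAry L T n → Σ ℕ λ k → k ≥ n × Ary L T k
proposition2p3 L T n _ (φs , almostAry) = k , n≤k , λ φ → EquivBC-bind L T isKFormula {φ} (almostAry φ)
  where
  bound = max 0 (map (varBound L) φs)
  k = 2 + (n + bound)

  n≤k : n ≤ k
  n≤k = ≤-trans (m≤m+n n bound) (m≤n+m _ 2)

  bound≤k : bound ≤ k
  bound≤k = ≤-trans (m≤n+m bound n) (m≤n+m _ 2)

  isKFormula : ∀ {ψ} → NFormula L T n ψ ⊎ Lift _ (∃ λ χ → χ ∈ φs × ∃ λ σ → ψ ≡ rename L σ χ) →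
               NFormula L T k ψ
  isKFormula {ψ} (inj₁ nFormula) = NFormula-mono L T {φ = ψ} n≤k nFormula
  isKFormula (inj₂ (lift (χ , χ∈φs , σ , refl))) =
    rename-NFormula L T σ χ (≤-trans (All.lookup (xs≤max 0 _) (∈-map⁺ (varBound L) χ∈φs)) bound≤k)
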